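{- Let $R$ be a lie restriction and $G$ a lie restriction graph for $R$. The Seeker wins from every position if and only if the Seeker wins from every position of weight two.
   Context: A lie restriction $R$ is a set of finite binary strings that is prefix-closed (every prefix of a member is a member) and extensible (every member can be extended by one letter to a member). A lie restriction graph $G$ for $R$ is a directed graph with a designated start vertex, arcs labeled $0$ or $1$, each vertex having at least one and at most two outgoing arcs with at most one outgoing arc of each label, such that a binary string lies in $R$ iff it is the label sequence of a directed path in $G$ starting at the start vertex. A position is a map $P$ from the vertices of $G$ to the nonnegative integers with finitely many nonzero values; its weight is $\sum_v P(v)$. A pair $(P_1,P_2)$ is a split of $P$ if there are positions $Q_0,Q_1$ with $P=Q_0+Q_1$ pointwise, $P_1(v)=\sum Q_0(u)$ over all $u$ with a $0$-arc from $u$ to $v$, and $P_2(v)=\sum Q_1(u)$ over all $u$ with a $1$-arc from $u$ to $v$. A strategy tree for $P$ is a finite rooted binary tree whose vertices are positions, with root $P$, such that the two children of every non-leaf vertex form a split of it, and every leaf has weight $0$ or $1$. The Seeker wins from $P$ iff a strategy tree for $P$ exists. -}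

module Defs where

open import Data.Bool using (Bool; true; false)
open import Data.Maybe using (Maybe; just; nothing)
open import Data.List using (List; []; _∷_; _++_; [_]; length; mapMaybe)
open import Data.Nat using (ℕ; _≤_)
open import Data.Product using (Σ; ∃; ∃-syntax; _×_; _,_)
open import Data.Sum using (_⊎_)
open import Relation.Binary.PropositionalEquality using (_≡_)
open import Function.Bundles using (_⇔_)
open import Data.List.Relation.Binary.Permutation.Propositional using (_↭_)

-- Binary strings: letter 0 = false, letter 1 = true.
BinStr : Set
BinStr = List Bool

Lang : Set₁
Lang = BinStr → Set

record IsLieRestriction (R : Lang) : Set where
  field
    prefixClosed : ∀ (w u : BinStr) → R (w ++ u) → R w
    extensible   : ∀ (w : BinStr) → R w → ∃[ b ] R (w ++ [ b ])

-- A directed graph with labelled arcs, each vertex having at most one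
-- outgoing arc of each label (arc b v = just u  means a b-arc v → u)
-- and at least one outgoing arc; with a designated start vertex.
record LabelledGraph : Set₁ where
  field
    V     : Set
    start : V
    arc   : Bool → V → Maybe V
    atLeastOne : ∀ (v : V) → (∃[ u ] arc false v ≡ just u) ⊎ (∃[ u ] arc true v ≡ just u)

module _ (G : LabelledGraph) where
  open LabelledGraph G

  data PathFrom : V → BinStr → Set where
    []  : ∀ {v} → PathFrom v []
    _∷_ : ∀ {v u b w} → arc b v ≡ just u → PathFrom u w → PathFrom v (b ∷ w)

  IsGraphFor : Lang → Set
  IsGraphFor R = ∀ (w : BinStr) → R w ⇔ PathFrom start w

  -- A position: a finitely supported map V → ℕ, represented as a finite
  -- multiset of vertices, i.e. a list up to permutation; P(v) is the
  -- number of occurrences of v in the list.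
  Position : Set
  Position = List V

  weight : Position → ℕ
  weight = length

  -- (P₁ , P₂) is a split of P:  P = Q₀ + Q₁,
  -- P₁(v) = Σ_{u --0--> v} Q₀(u),  P₂(v) = Σ_{u --1--> v} Q₁(u).
  -- Since each vertex has at most one 0-arc (resp. 1-arc), the multiset
  -- P₁ is the image of Q₀ under the partial 0-successor map.
  IsSplit : Position → Position → Position → Set
  IsSplit P P₁ P₂ = Σ Position λ Q₀ → Σ Position λ Q₁ →
      (P ↭ Q₀ ++ Q₁) × (P₁ ↭ mapMaybe (arc false) Q₀) × (P₂ ↭ mapMaybe (arc true) Q₁)

  data StrategyTree : Position → Set where
    leaf : ∀ {P} → weight P ≤ 1 → StrategyTree P
    node : ∀ {P} (P₁ P₂ : Position) → IsSplit P P₁ P₂ →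
           StrategyTree P₁ → StrategyTree P₂ → StrategyTree P

  SeekerWins : Position → Set
  SeekerWins P = StrategyTree P

{-# OPTIONS --safe #-}
module Submission where

-- Play a winning strategy for two chips a, b from a, b together with any
-- further chips X, always sending all of X along their 0-arcs.  A chip has
-- at most one 0-arc, so the extra chips never multiply; at each leaf at most
-- one of a, b is left beside at most |X| other chips, a position of smaller
-- weight than a, b, X, from which the Seeker wins by induction on weight.

open import Defs
open import Data.List using ([]; _∷_; _++_; [_]; mapMaybe)
open import Data.List.Properties using (++-assoc; length-++; length-mapMaybe; mapMaybe-++)
open import Data.Nat using (ℕ; suc; _≤_; z≤n; s≤s)
open import Data.Nat.Properties using (≤-refl; ≤-trans; +-monoˡ-≤)
open import Data.Bool using (false)
open import Data.Product using (_,_)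
open import Relation.Binary.PropositionalEquality using (_≡_; refl; sym; subst)
open import Function.Bundles using (_⇔_; mk⇔)
open import Data.List.Relation.Binary.Permutation.Propositional using (_↭_; module PermutationReasoning)
open import Data.List.Relation.Binary.Permutation.Propositional.Properties using (++⁺ˡ; ++⁺ʳ; ++-comm)

module _ (G : LabelledGraph) where
  open LabelledGraph G

  IsSplit-++-false : ∀ {P P₁ P₂} (X : Position G) → IsSplit G P P₁ P₂ →
                     IsSplit G (P ++ X) (P₁ ++ mapMaybe (arc false) X) P₂
  IsSplit-++-false {P} {P₁} X (Q₀ , Q₁ , P↭Q₀Q₁ , P₁↭ , P₂↭) =
    Q₀ ++ X , Q₁ , P++X↭ , P₁++X↭ , P₂↭
    where
    open PermutationReasoning

    P++X↭ : P ++ X ↭ (Q₀ ++ X) ++ Q₁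
    P++X↭ = begin
      P ++ X           ↭⟨ ++⁺ʳ X P↭Q₀Q₁ ⟩
      (Q₀ ++ Q₁) ++ X  ≡⟨ ++-assoc Q₀ Q₁ X ⟩
      Q₀ ++ Q₁ ++ X    ↭⟨ ++⁺ˡ Q₀ (++-comm Q₁ X) ⟩
      Q₀ ++ X ++ Q₁    ≡⟨ ++-assoc Q₀ X Q₁ ⟨
      (Q₀ ++ X) ++ Q₁  ∎

    P₁++X↭ : P₁ ++ mapMaybe (arc false) X ↭ mapMaybe (arc false) (Q₀ ++ X)
    P₁++X↭ = begin
      P₁ ++ mapMaybe (arc false) X                       ↭⟨ ++⁺ʳ _ P₁↭ ⟩
      mapMaybe (arc false) Q₀ ++ mapMaybe (arc false) X  ≡⟨ mapMaybe-++ (arc false) Q₀ X ⟨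
      mapMaybe (arc false) (Q₀ ++ X)                     ∎

  WinsUpTo : ℕ → Set
  WinsUpTo n = ∀ P → weight G P ≤ n → SeekerWins G P

  WinsUpTo-antitone : ∀ {m n} → m ≤ n → WinsUpTo n → WinsUpTo m
  WinsUpTo-antitone m≤n wins P P≤m = wins P (≤-trans P≤m m≤n)

  wins-++ : ∀ {P} X → WinsUpTo (suc (weight G X)) → SeekerWins G P → SeekerWins G (P ++ X)
  wins-++ {P} X wins (leaf P≤1) =
    wins (P ++ X) (subst (_≤ suc (weight G X)) (sym (length-++ P)) (+-monoˡ-≤ (weight G X) P≤1))
  wins-++ X wins (node P₁ P₂ split T₁ T₂) =
    node _ P₂ (IsSplit-++-false X split)
      (wins-++ (mapMaybe (arc false) X)
        (WinsUpTo-antitone (s≤s (length-mapMaybe (arc false) X)) wins) T₁)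
      T₂

  wins-from-weight-two : (∀ P → weight G P ≡ 2 → SeekerWins G P) → ∀ n → WinsUpTo n
  wins-from-weight-two wins₂ n       []            _ = leaf z≤n
  wins-from-weight-two wins₂ n       (a ∷ [])      _ = leaf (s≤s z≤n)
  wins-from-weight-two wins₂ (suc n) (a ∷ b ∷ X)   (s≤s X+1≤n) =
    wins-++ X (WinsUpTo-antitone X+1≤n (wins-from-weight-two wins₂ n)) (wins₂ (a ∷ [ b ]) refl)

theorem1 : (R : Lang) → IsLieRestriction R → (G : LabelledGraph) → IsGraphFor G R →
    ((P : Position G) → SeekerWins G P) ⇔ ((P : Position G) → weight G P ≡ 2 → SeekerWins G P)
theorem1 R _ G _ = mk⇔
  (λ wins P _ → wins P)
  (λ wins₂ P → wins-from-weight-two G wins₂ (weight G P) P ≤-refl)
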